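{- Let $\mu=(\mathrm{Val},(\mathcal P,\mathcal O),\varsigma)$ be a model for the predicate symbols $\mathrm{broadcast},\mathrm{echo},\mathrm{ready},\mathrm{deliver}$ whose semitopology is 3-twined, and suppose every axiom of $\mathrm{ThyBB}$ is valid in $\mu$. Let $v\in\mathrm{Val}$. Then: (1) if $\models\mathsf{Everywhere}\,\mathrm{echo}(v)$ then $\models\mathsf T\,\mathsf{Quorum}\,\mathrm{echo}(v)$; (2) if $\models\mathsf{Everywhere}\,\mathrm{ready}(v)$ then $\models\mathsf T\,\mathsf{Quorum}\,\mathrm{ready}(v)$.
   Context: Truth values: $\mathbf 3=\{\mathbf f,\mathbf b,\mathbf t\}$ totally ordered by $\mathbf f<\mathbf b<\mathbf t$; $\wedge,\vee$ are min and max, $\bigwedge,\bigvee$ are infimum and supremum. Negation: $\neg\mathbf t=\mathbf f$, $\neg\mathbf b=\mathbf b$, $\neg\mathbf f=\mathbf t$. Modalities: $\mathsf T x=\mathbf t$ if $x=\mathbf t$, else $\mathbf f$; $\mathsf B x=\mathbf t$ if $x=\mathbf b$, else $\mathbf f$; $\mathsf{TF}x=\mathbf t$ if $x\in\{\mathbf t,\mathbf f\}$, else $\mathbf f$. Weak implication: $x\to_w y:=\neg x\vee y$. A truth value is valid iff it lies in $\{\mathbf t,\mathbf b\}$. A semitopology $(\mathcal P,\mathcal O)$ is a set $\mathcal P$ with a family $\mathcal O$ of subsets containing $\mathcal P$ and closed under arbitrary (including empty) unions; $\mathcal O^{\neq\emptyset}$ is the set of nonempty members. It is 3-twined if any three members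 of $\mathcal O^{\neq\emptyset}$ have nonempty intersection. For $f:\mathcal P\to\mathbf 3$: $\mathsf{Everywhere} f=\bigwedge_{p}f(p)$, $\mathsf{Somewhere} f=\bigvee_p f(p)$, $\mathsf{Quorum} f=\bigvee_{O\in\mathcal O^{\neq\emptyset}}\bigwedge_{p\in O}f(p)$, $\mathsf{Contraquorum} f=\bigwedge_{O\in\mathcal O^{\neq\emptyset}}\bigvee_{p\in O}f(p)$. Logic: a model $\mu=(\mathrm{Val},(\mathcal P,\mathcal O),\varsigma)$ consists of a nonempty set $\mathrm{Val}$, a semitopology, and for each predicate symbol $R$ a function $\varsigma(R):\mathcal P\to\mathrm{Val}\to\mathbf 3$. Formulas are built from atoms $R(t)$, value equalities $v\doteq v'$ (denoting $\mathbf t$ if $v=v'$, else $\mathbf f$), connectives $\neg,\wedge,\vee,\to_w$, modalities $\mathsf T,\mathsf B,\mathsf{TF}$, operators $\mathsf{Everywhere},\mathsf{Somewhere},\mathsf{Quorum},\mathsf{Contraquorum}$ and quantifiers over $\mathrm{Val}$. Denotation $[\![\phi]\!]:\mathcal P\to\mathbf 3$: $[\![R(v)]\!](p)=\varsigma(R)(p)(v)$; connectives and modalities pointwise in $p$; $[\![\mathsf{Quorum}\,\phi]\!](p)=\mathsf{Quorum}([\![\phi]\!])$ for all $p$, likewise for the other three operators; $[\![\exists a.\phi]\!](p)=\bigvee_{v}[\![\phi[a:=v]]\!](p)$, $[\![\forall a.\phi]\!](p)=\bigwedge_{v}[\![\phi[a:=v]]\!](p)$; $[\![\exists_{01}a.\phi]\!](p)=\bigwedge_{v,v'}\big(([\![\phi[a:=v]]\!](p)\wedge[\![\phi[a:=v']]\!](p))\to_w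 (v\doteq v')\big)$; $\exists_1 a.\phi:=(\exists_{01}a.\phi)\wedge(\exists a.\phi)$. $p\models\phi$ iff $[\![\phi]\!](p)\in\{\mathbf t,\mathbf b\}$; $\models\phi$ iff $p\models\phi$ for all $p$. $\mathrm{correct}(R):=\forall a.\mathsf{TF}R(a)$, $\mathrm{incorrect}(R):=\forall a.\mathsf B R(a)$. Axioms with a free variable $a$ are universally quantified over $a$; an axiom is valid in $\mu$ if $\models$ it. $\mathrm{ThyBB}$ consists of: BrDeliver?: $\mathrm{deliver}(a)\to_w\mathsf{Quorum}\,\mathrm{ready}(a)$; BrReady?: $\mathrm{ready}(a)\to_w\mathsf{Quorum}\,\mathrm{echo}(a)$; BrEcho?: $\mathrm{echo}(a)\to_w\mathsf{Somewhere}\,\mathrm{broadcast}(a)$; BrEcho01: $\exists_{01}a.\mathrm{echo}(a)$; BrBroadcast1: $\exists_1 a.\mathsf{Somewhere}\,\mathrm{broadcast}(a)$; BrDeliver!: $\mathsf{Quorum}\,\mathrm{ready}(a)\to_w\mathrm{deliver}(a)$; BrReady!: $\mathsf{Quorum}\,\mathrm{echo}(a)\to_w\mathrm{ready}(a)$; BrEcho!: $\mathsf{Somewhere}\,\mathrm{broadcast}(a)\to_w\exists a.\mathrm{echo}(a)$; BrReady!!: $\mathsf{Contraquorum}\,\mathrm{ready}(a)\to_w\mathrm{ready}(a)$; BrCorrect: $\mathsf{Quorum}\,\mathrm{correct}(\mathrm{ready})\wedge\mathsf{Quorum}\,\mathrm{correct}(\mathrm{echo})$; BrCorrect': $\mathrm{correct}(R)\vee\mathrm{incorrect}(R)$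 for $R\in\{\mathrm{ready},\mathrm{echo}\}$; BrCorrect'': $\mathsf{Everywhere}\,\mathrm{correct}(\mathrm{broadcast})\vee\mathsf{Everywhere}\,\mathrm{incorrect}(\mathrm{broadcast})$. -}

module Defs where

open import Level using (Level; Lift; lift; lower) renaming (zero to 0ℓ; suc to sucℓ)
open import Data.Empty using (⊥)
open import Data.Unit using (⊤; tt)
open import Data.Product using (Σ; ∃; _×_; _,_; proj₁; proj₂)
open import Data.Sum using (_⊎_; inj₁; inj₂)
open import Relation.Nullary using (¬_)
open import Relation.Binary.PropositionalEquality using (_≡_)
open import Function using (_↔_)

data 𝟛 : Set where
  𝐟 𝐛 𝐭 : 𝟛

≥𝐛 : 𝟛 → Set
≥𝐛 𝐟 = ⊥
≥𝐛 𝐛 = ⊤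
≥𝐛 𝐭 = ⊤

≥𝐭 : 𝟛 → Set
≥𝐭 𝐟 = ⊥
≥𝐭 𝐛 = ⊥
≥𝐭 𝐭 = ⊤

≥𝐭⇒≥𝐛 : ∀ x → ≥𝐭 x → ≥𝐛 x
≥𝐭⇒≥𝐛 𝐭 _ = tt

-- Arbitrary infima/suprema in 𝟛 are not
-- computable constructively, so a (denoted) truth value is represented by
-- its two upper-set memberships  "≥ b"  and  "≥ t"  (propositions, with
-- ≥ t implying ≥ b).  Classically this is exactly 𝟛:
--   f ↦ (⊥,⊥),  b ↦ (⊤,⊥),  t ↦ (⊤,⊤).

record T3 : Set₂ where
  constructor mkT3
  field
    atLeastB : Set₁
    atLeastT : Set₁
    t⇒b      : atLeastT → atLeastB
open T3 public

⌜_⌝ : 𝟛 → T3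
⌜ x ⌝ = mkT3 (Lift _ (≥𝐛 x)) (Lift _ (≥𝐭 x)) (λ p → lift (≥𝐭⇒≥𝐛 x (lower p)))

Valid : T3 → Set₁
Valid x = atLeastB x

IsTrue : T3 → Set₁
IsTrue x = atLeastT x

_∧ᵗ_ : T3 → T3 → T3
x ∧ᵗ y = mkT3 (atLeastB x × atLeastB y) (atLeastT x × atLeastT y)
              (λ { (p , q) → t⇒b x p , t⇒b y q })

_∨ᵗ_ : T3 → T3 → T3
x ∨ᵗ y = mkT3 (atLeastB x ⊎ atLeastB y) (atLeastT x ⊎ atLeastT y)
              (λ { (inj₁ p) → inj₁ (t⇒b x p) ; (inj₂ q) → inj₂ (t⇒b y q) })

-- ¬t = f, ¬b = b, ¬f = t
¬ᵗ_ : T3 → T3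
¬ᵗ x = mkT3 (¬ atLeastT x) (¬ atLeastB x) (λ nb nt → nb (t⇒b x nt))

_→ᵗ_ : T3 → T3 → T3
x →ᵗ y = (¬ᵗ x) ∨ᵗ y

Tᵗ : T3 → T3
Tᵗ x = mkT3 (atLeastT x) (atLeastT x) (λ p → p)

Bᵗ : T3 → T3
Bᵗ x = mkT3 (atLeastB x × ¬ atLeastT x) (atLeastB x × ¬ atLeastT x) (λ p → p)

TFᵗ : T3 → T3
TFᵗ x = mkT3 (atLeastT x ⊎ ¬ atLeastB x) (atLeastT x ⊎ ¬ atLeastB x) (λ p → p)

⋀ᵗ : (I : Set₁) → (I → T3) → T3
⋀ᵗ I f = mkT3 ((i : I) → atLeastB (f i)) ((i : I) → atLeastT (f i))
              (λ h i → t⇒b (f i) (h i))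

⋁ᵗ : (I : Set₁) → (I → T3) → T3
⋁ᵗ I f = mkT3 (Σ I λ i → atLeastB (f i)) (Σ I λ i → atLeastT (f i))
              (λ { (i , p) → i , t⇒b (f i) p })

data Pred : Set where
  broadcast echo ready deliver : Pred

record Semitopology : Set₂ where
  field
    P     : Set
    Open  : (P → Set) → Set₁
    -- Open is a family of *sets*: invariant under extensional equality
    Open-ext   : ∀ {U V : P → Set} → (∀ p → U p ↔ V p) → Open U → Open V
    Open-whole : Open (λ _ → ⊤)
    Open-⋃     : (I : Set) (U : I → P → Set) → (∀ i → Open (U i)) →
                 Open (λ p → Σ I λ i → U i p)

  NonEmpty : (P → Set) → Set
  NonEmpty U = Σ P U

  record NEOpen : Set₁ where
    constructor neOpen
    field
      set      : P → Set
      isOpen   : Open set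
      nonEmpty : NonEmpty set

  ThreeTwined : Set₁
  ThreeTwined = ∀ (U V W : P → Set) → Open U → Open V → Open W →
                NonEmpty U → NonEmpty V → NonEmpty W →
                Σ P λ p → U p × V p × W p

record Model : Set₃ where
  field
    Val  : Set
    val₀ : Val
    topo : Semitopology
  open Semitopology topo public
  field
    ς    : Pred → P → Val → 𝟛

-- Denotational semantics (shallow embedding: a formula is its
-- denotation P → truth value).

module Sem (μ : Model) where
  open Model μ

  Form : Set₂
  Form = P → T3

  atom : Pred → Val → Form
  atom R v p = ⌜ ς R p v ⌝

  _≐_ : Val → Val → Form
  (v ≐ w) p = mkT3 (Lift _ (v ≡ w)) (Lift _ (v ≡ w)) (λ e → e)

  ¬ᶠ_ : Form → Form
  (¬ᶠ φ) p = ¬ᵗ φ p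

  _∧ᶠ_ _∨ᶠ_ _→w_ : Form → Form → Form
  (φ ∧ᶠ ψ) p = φ p ∧ᵗ ψ p
  (φ ∨ᶠ ψ) p = φ p ∨ᵗ ψ p
  (φ →w ψ) p = φ p →ᵗ ψ p

  Tᶠ Bᶠ TFᶠ : Form → Form
  Tᶠ φ p = Tᵗ (φ p)
  Bᶠ φ p = Bᵗ (φ p)
  TFᶠ φ p = TFᵗ (φ p)

  Everywhere Somewhere Quorum Contraquorum : Form → Form
  Everywhere φ _ = ⋀ᵗ (Lift _ P) (λ q → φ (lower q))
  Somewhere  φ _ = ⋁ᵗ (Lift _ P) (λ q → φ (lower q))
  Quorum φ _ =
    ⋁ᵗ NEOpen λ O →
      ⋀ᵗ (Lift _ (Σ P (NEOpen.set O))) λ q → φ (proj₁ (lower q))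
  Contraquorum φ _ =
    ⋀ᵗ NEOpen λ O →
      ⋁ᵗ (Lift _ (Σ P (NEOpen.set O))) λ q → φ (proj₁ (lower q))

  ∃ᶠ ∀ᶠ : (Val → Form) → Form
  ∃ᶠ φ p = ⋁ᵗ (Lift _ Val) λ v → φ (lower v) p
  ∀ᶠ φ p = ⋀ᵗ (Lift _ Val) λ v → φ (lower v) p

  ∃₀₁ : (Val → Form) → Form
  ∃₀₁ φ p = ⋀ᵗ (Lift _ (Val × Val)) λ vw →
              ((φ (proj₁ (lower vw)) ∧ᶠ φ (proj₂ (lower vw)))
                 →w (proj₁ (lower vw) ≐ proj₂ (lower vw))) p

  ∃₁ : (Val → Form) → Form
  ∃₁ φ = ∃₀₁ φ ∧ᶠ ∃ᶠ φ

  _⊩_ : P → Form → Set₁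
  p ⊩ φ = Valid (φ p)

  ⊨_ : Form → Set₁
  ⊨ φ = ∀ p → p ⊩ φ

  correct incorrect : Pred → Form
  correct R   = ∀ᶠ λ a → TFᶠ (atom R a)
  incorrect R = ∀ᶠ λ a → Bᶠ (atom R a)

  record ThyBB : Set₁ where
    field
      BrDeliver?   : ∀ a → ⊨ (atom deliver a →w Quorum (atom ready a))
      BrReady?     : ∀ a → ⊨ (atom ready a →w Quorum (atom echo a))
      BrEcho?      : ∀ a → ⊨ (atom echo a →w Somewhere (atom broadcast a))
      BrEcho01     : ⊨ (∃₀₁ λ a → atom echo a)
      BrBroadcast1 : ⊨ (∃₁ λ a → Somewhere (atom broadcast a))
      BrDeliver!   : ∀ a → ⊨ (Quorum (atom ready a) →w atom deliver a)
      BrReady!     : ∀ a → ⊨ (Quorum (atom echo a) →w atom ready a)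
      BrEcho!      : ∀ a → ⊨ (Somewhere (atom broadcast a) →w (∃ᶠ λ a' → atom echo a'))
      BrReady!!    : ∀ a → ⊨ (Contraquorum (atom ready a) →w atom ready a)
      BrCorrect    : ⊨ (Quorum (correct ready) ∧ᶠ Quorum (correct echo))
      BrCorrect'ready : ⊨ (correct ready ∨ᶠ incorrect ready)
      BrCorrect'echo  : ⊨ (correct echo ∨ᶠ incorrect echo)
      BrCorrect''  : ⊨ (Everywhere (correct broadcast) ∨ᶠ Everywhere (incorrect broadcast))

-- A correct participant's echo/ready value is never b.  BrCorrect supplies a
-- quorum of such participants; if R(v) is valid everywhere, then on that quorum
-- it is valid and not b, i.e. t, so Quorum R(v) is t.
module Submission where

open import Defs
open import Data.Product using (_×_; _,_; proj₁; proj₂)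
open import Data.Sum using (inj₁; inj₂)
open import Data.Empty using (⊥-elim)
open import Level using (lift; lower)

TF∧valid⇒true : (x : T3) → IsTrue (TFᵗ x) → Valid x → IsTrue x
TF∧valid⇒true x (inj₁ true)    _     = true
TF∧valid⇒true x (inj₂ invalid) valid = ⊥-elim (invalid valid)

module _ (μ : Model) where
  open Model μ
  open Sem μ

  Quorum-correct∧Everywhere⇒T-Quorum : (R : Pred) (v : Val) →
    ⊨ Quorum (correct R) → ⊨ Everywhere (atom R v) → ⊨ Tᶠ (Quorum (atom R v))
  Quorum-correct∧Everywhere⇒T-Quorum R v quorum-correct everywhere p
    with quorum-correct p
  ... | O , correct-on-O = O , λ q →
    let r = proj₁ (lower q) in
    TF∧valid⇒true (atom R v r) (correct-on-O q (lift v)) (everywhere p (lift r))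

lemma4p14 : (μ : Model) → Model.ThreeTwined μ → Sem.ThyBB μ →
    (v : Model.Val μ) →
    let open Sem μ in
    ((⊨ Everywhere (atom echo v)) → (⊨ Tᶠ (Quorum (atom echo v))))
    × ((⊨ Everywhere (atom ready v)) → (⊨ Tᶠ (Quorum (atom ready v))))
lemma4p14 μ _ thy v =
    Quorum-correct∧Everywhere⇒T-Quorum μ echo  v (λ p → proj₂ (BrCorrect p))
  , Quorum-correct∧Everywhere⇒T-Quorum μ ready v (λ p → proj₁ (BrCorrect p))
  where open Sem.ThyBB thy
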